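{- Let $a,b,c$ be integers, each $\ge 10$. Then $(a\_b)\_c \;\ge\; a\_(b\_c)$.
   Context: For a positive integer $a$ with decimal expansion $a=\sum_{i=0}^{k} c_i 10^i$, $c_i\in\{0,\dots,9\}$, $c_k\neq 0$, and a real number $b>1$, the number $a\_b$ (also written $a_b$) is defined as $\sum_{i=0}^{k} c_i b^i$, i.e. the decimal digit string of $a$ interpreted in base $b$. When $b$ is itself an integer $\ge 10$, $a\_b$ is again a positive integer, so expressions like $(a\_b)\_c$ and $a\_(b\_c)$ are defined. -}

module Defs where

open import Data.Nat using (ℕ; zero; suc; _+_; _*_)
open import Data.Nat.DivMod using (_/_; _%_)

-- reinterpAux fuel a b : the decimal digit string of a read in base b,
-- computed by peeling off the last decimal digit (a % 10) and recursing on a / 10.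
-- The fuel argument only guarantees termination; with fuel ≥ a it is exact
-- (a / 10 < a for a ≥ 1, and the value for a = 0 is 0).
reinterpAux : ℕ → ℕ → ℕ → ℕ
reinterpAux zero       a b = 0
reinterpAux (suc fuel) zero b = 0
reinterpAux (suc fuel) a@(suc _) b = a % 10 + b * reinterpAux fuel (a / 10) b

_⟨_⟩ : ℕ → ℕ → ℕ
a ⟨ b ⟩ = reinterpAux a a b

{-# OPTIONS --safe #-}
-- Fix c ≥ 10 and write F n = n ⟨ c ⟩.  Digit by digit, F is superadditive
-- (a decimal carry turns 10 into c ≥ 10) and hence supermultiplicative, and
-- n ≤ F n.  If a has last digit d, then a ⟨ F b ⟩ = d + F b · a′ ⟨ F b ⟩, and
-- bounding each term by F lets superadditivity and supermultiplicativity
-- reassemble F (d + b · a′ ⟨ b ⟩) = F (a ⟨ b ⟩).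
module Submission where

open import Defs
open import Data.Nat using (ℕ; zero; suc; _+_; _*_; _∸_; _≤_; _≥_; _<_; z≤n; s≤s)
open import Data.Nat.Properties
open import Data.Nat.DivMod
open import Data.Nat.Divisibility using (divides-refl)
open import Data.Nat.Induction using (<-rec)
open import Data.Nat.Tactic.RingSolver using (solve-∀)
open import Relation.Binary.PropositionalEquality
open import Relation.Nullary using (yes; no)

digit-induction : (P : ℕ → Set) → P 0 → (∀ r q → r < 10 → P q → P (r + q * 10)) →
                  ∀ n → P n
digit-induction P P0 P-digit = <-rec P step
  where
  step : ∀ n → (∀ {m} → m < n → P m) → P n
  step zero      _  = P0
  step n@(suc _) ih = subst P (sym (m≡m%n+[m/n]*n n 10))
    (P-digit (n % 10) (n / 10) (m%n<n n 10) (ih (m/n<m n 10 (s≤s (s≤s z≤n)))))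

module _ (b : ℕ) where

  reinterpAux-zero : ∀ f → reinterpAux f 0 b ≡ 0
  reinterpAux-zero zero    = refl
  reinterpAux-zero (suc f) = refl

  reinterpAux-fuel-irrelevant : ∀ f g n → n ≤ f → n ≤ g →
                                reinterpAux f n b ≡ reinterpAux g n b
  reinterpAux-fuel-irrelevant f g zero _ _ =
    trans (reinterpAux-zero f) (sym (reinterpAux-zero g))
  reinterpAux-fuel-irrelevant (suc f) (suc g) n@(suc _) n≤1+f n≤1+g =
    cong (λ t → n % 10 + b * t)
      (reinterpAux-fuel-irrelevant f g (n / 10) (<⇒≤pred (<-≤-trans n/10<n n≤1+f))
                                                (<⇒≤pred (<-≤-trans n/10<n n≤1+g)))
    where n/10<n = m/n<m n 10 (s≤s (s≤s z≤n))

  ⟨⟩-unfold : ∀ n → n ⟨ b ⟩ ≡ n % 10 + b * (n / 10) ⟨ b ⟩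
  ⟨⟩-unfold zero        = sym (*-zeroʳ b)
  ⟨⟩-unfold n@(suc n-1) = cong (λ t → n % 10 + b * t)
    (reinterpAux-fuel-irrelevant n-1 (n / 10) (n / 10)
      (<⇒≤pred (m/n<m n 10 (s≤s (s≤s z≤n)))) ≤-refl)

  ⟨⟩-digit : ∀ r q → r < 10 → (r + q * 10) ⟨ b ⟩ ≡ r + b * q ⟨ b ⟩
  ⟨⟩-digit r q r<10 =
    trans (⟨⟩-unfold (r + q * 10)) (cong₂ (λ u v → u + b * v ⟨ b ⟩) last-digit rest)
    where
    last-digit : (r + q * 10) % 10 ≡ r
    last-digit = trans ([m+kn]%n≡m%n r q 10) (m<n⇒m%n≡m r<10)
    rest : (r + q * 10) / 10 ≡ q
    rest = trans (+-distrib-/-∣ʳ r (divides-refl q))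
                 (cong₂ _+_ (m<n⇒m/n≡0 r<10) (m*n/n≡m q 10))

  ⟨⟩-1 : 1 ⟨ b ⟩ ≡ 1
  ⟨⟩-1 = trans (⟨⟩-digit 1 0 (s≤s (s≤s z≤n))) (cong (1 +_) (*-zeroʳ b))

  ⟨⟩-*10 : ∀ q → (q * 10) ⟨ b ⟩ ≡ b * q ⟨ b ⟩
  ⟨⟩-*10 q = ⟨⟩-digit 0 q (s≤s z≤n)

module _ (c : ℕ) (c≥10 : c ≥ 10) where

  private
    F : ℕ → ℕ
    F n = n ⟨ c ⟩

  ⟨⟩-<-suc : ∀ n → F n < F (suc n)
  ⟨⟩-<-suc = digit-induction (λ n → F n < F (suc n)) (≤-reflexive (sym (⟨⟩-1 c))) step
    where
    step : ∀ r q → r < 10 → F q < F (suc q) → F (r + q * 10) < F (suc (r + q * 10))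
    step r q r<10 ih with r ≟ 9
    ... | yes refl = begin
      suc (F (9 + q * 10))  ≡⟨ cong suc (⟨⟩-digit c 9 q r<10) ⟩
      10 + c * F q          ≤⟨ +-monoˡ-≤ (c * F q) c≥10 ⟩
      c + c * F q           ≡⟨ sym (*-suc c (F q)) ⟩
      c * suc (F q)         ≤⟨ *-monoʳ-≤ c ih ⟩
      c * F (suc q)         ≡⟨ sym (⟨⟩-*10 c (suc q)) ⟩
      F (suc (9 + q * 10))  ∎
      where open ≤-Reasoning
    ... | no r≢9 = ≤-reflexive (trans (cong suc (⟨⟩-digit c r q r<10))
                                      (sym (⟨⟩-digit c (suc r) q 1+r<10)))
      where 1+r<10 = ≤∧≢⇒< r<10 (λ 1+r≡10 → r≢9 (suc-injective 1+r≡10))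

  ⟨⟩-+-digits : ∀ d x e y → d < 10 → e < 10 →
                F (d + x * 10) + F (e + y * 10) ≡ (d + e) + c * (F x + F y)
  ⟨⟩-+-digits d x e y d<10 e<10 =
    trans (cong₂ _+_ (⟨⟩-digit c d x d<10) (⟨⟩-digit c e y e<10)) (distrib d e c (F x) (F y))
    where
    distrib : ∀ d e c X Y → (d + c * X) + (e + c * Y) ≡ (d + e) + c * (X + Y)
    distrib = solve-∀

  ⟨⟩-+-without-carry : ∀ d x e y → d < 10 → e < 10 → d + e < 10 → F x + F y ≤ F (x + y) →
                       F (d + x * 10) + F (e + y * 10) ≤ F ((d + e) + (x + y) * 10)
  ⟨⟩-+-without-carry d x e y d<10 e<10 d+e<10 sup = begin
    F (d + x * 10) + F (e + y * 10)  ≡⟨ ⟨⟩-+-digits d x e y d<10 e<10 ⟩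
    (d + e) + c * (F x + F y)        ≤⟨ +-monoʳ-≤ (d + e) (*-monoʳ-≤ c sup) ⟩
    (d + e) + c * F (x + y)          ≡⟨ sym (⟨⟩-digit c (d + e) (x + y) d+e<10) ⟩
    F ((d + e) + (x + y) * 10)       ∎
    where open ≤-Reasoning

  ⟨⟩-+-with-carry : ∀ d x e y s → d < 10 → e < 10 → d + e ≡ 10 + s → F x + F y ≤ F (x + y) →
                    F (d + x * 10) + F (e + y * 10) ≤ F (s + suc (x + y) * 10)
  ⟨⟩-+-with-carry d x e y s d<10 e<10 d+e≡10+s sup = begin
    F (d + x * 10) + F (e + y * 10)  ≡⟨ ⟨⟩-+-digits d x e y d<10 e<10 ⟩
    (d + e) + c * (F x + F y)        ≡⟨ cong (_+ c * (F x + F y)) d+e≡10+s ⟩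
    (10 + s) + c * (F x + F y)       ≤⟨ +-monoˡ-≤ (c * (F x + F y)) (+-monoˡ-≤ s c≥10) ⟩
    (c + s) + c * (F x + F y)        ≡⟨ absorb c s (F x + F y) ⟩
    s + c * suc (F x + F y)          ≤⟨ +-monoʳ-≤ s (*-monoʳ-≤ c (<-≤-trans (s≤s sup) (⟨⟩-<-suc (x + y)))) ⟩
    s + c * F (suc (x + y))          ≡⟨ sym (⟨⟩-digit c s (suc (x + y)) s<10) ⟩
    F (s + suc (x + y) * 10)         ∎
    where
    open ≤-Reasoning
    absorb : ∀ c s Z → (c + s) + c * Z ≡ s + c * suc Z
    absorb = solve-∀
    s<10 : s < 10
    s<10 = +-cancelˡ-< 10 s 10 (subst (_< 20) d+e≡10+s (+-mono-< d<10 e<10))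

  ⟨⟩-superadditive : ∀ m n → F m + F n ≤ F (m + n)
  ⟨⟩-superadditive = digit-induction (λ m → ∀ n → F m + F n ≤ F (m + n)) (λ _ → ≤-refl) step
    where
    regroup : ∀ d x e y → (d + x * 10) + (e + y * 10) ≡ (d + e) + (x + y) * 10
    regroup = solve-∀

    step : ∀ d x → d < 10 → (∀ y → F x + F y ≤ F (x + y)) →
           ∀ n → F (d + x * 10) + F n ≤ F ((d + x * 10) + n)
    step d x d<10 ih n with n % 10 | n / 10 | m%n<n n 10 | m≡m%n+[m/n]*n n 10
    ... | e | y | e<10 | refl rewrite regroup d x e y with d + e <? 10
    ...   | yes d+e<10 = ⟨⟩-+-without-carry d x e y d<10 e<10 d+e<10 (ih y)
    ...   | no d+e≮10  = subst (λ k → F (d + x * 10) + F (e + y * 10) ≤ F k) (sym carry)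
                             (⟨⟩-+-with-carry d x e y s d<10 e<10 d+e≡10+s (ih y))
      where
      s = d + e ∸ 10
      d+e≡10+s : d + e ≡ 10 + s
      d+e≡10+s = sym (m+[n∸m]≡n (≮⇒≥ d+e≮10))
      carry : (d + e) + (x + y) * 10 ≡ s + suc (x + y) * 10
      carry = trans (cong (_+ (x + y) * 10) (trans d+e≡10+s (+-comm 10 s)))
                    (+-assoc s 10 ((x + y) * 10))

  *-⟨⟩-≤ : ∀ k n → k * F n ≤ F (k * n)
  *-⟨⟩-≤ zero    n = z≤n
  *-⟨⟩-≤ (suc k) n = ≤-trans (+-monoʳ-≤ (F n) (*-⟨⟩-≤ k n)) (⟨⟩-superadditive n (k * n))

  ≤-⟨⟩ : ∀ n → n ≤ F n
  ≤-⟨⟩ n = subst₂ _≤_ (trans (cong (n *_) (⟨⟩-1 c)) (*-identityʳ n)) (cong F (*-identityʳ n))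
                      (*-⟨⟩-≤ n 1)

  ⟨⟩-supermultiplicative : ∀ m n → F m * F n ≤ F (m * n)
  ⟨⟩-supermultiplicative = digit-induction (λ m → ∀ n → F m * F n ≤ F (m * n)) (λ _ → z≤n) step
    where
    distrib : ∀ d c X Y → (d + c * X) * Y ≡ d * Y + c * (X * Y)
    distrib = solve-∀
    regroup : ∀ d x y → (d + x * 10) * y ≡ d * y + (x * y) * 10
    regroup = solve-∀

    step : ∀ d x → d < 10 → (∀ n → F x * F n ≤ F (x * n)) →
           ∀ n → F (d + x * 10) * F n ≤ F ((d + x * 10) * n)
    step d x d<10 ih n = begin
      F (d + x * 10) * F n          ≡⟨ cong (_* F n) (⟨⟩-digit c d x d<10) ⟩
      (d + c * F x) * F n           ≡⟨ distrib d c (F x) (F n) ⟩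
      d * F n + c * (F x * F n)     ≤⟨ +-mono-≤ (*-⟨⟩-≤ d n) (*-monoʳ-≤ c (ih n)) ⟩
      F (d * n) + c * F (x * n)     ≡⟨ cong (F (d * n) +_) (sym (⟨⟩-*10 c (x * n))) ⟩
      F (d * n) + F ((x * n) * 10)  ≤⟨ ⟨⟩-superadditive (d * n) ((x * n) * 10) ⟩
      F (d * n + (x * n) * 10)      ≡⟨ cong F (sym (regroup d x n)) ⟩
      F ((d + x * 10) * n)          ∎
      where open ≤-Reasoning

  ⟨⟩-⟨⟩-≤ : ∀ a b → a ⟨ F b ⟩ ≤ F (a ⟨ b ⟩)
  ⟨⟩-⟨⟩-≤ a b = digit-induction (λ a → a ⟨ F b ⟩ ≤ F (a ⟨ b ⟩)) z≤n step a
    where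
    step : ∀ d a → d < 10 → a ⟨ F b ⟩ ≤ F (a ⟨ b ⟩) → (d + a * 10) ⟨ F b ⟩ ≤ F ((d + a * 10) ⟨ b ⟩)
    step d a d<10 ih = begin
      (d + a * 10) ⟨ F b ⟩      ≡⟨ ⟨⟩-digit (F b) d a d<10 ⟩
      d + F b * a ⟨ F b ⟩       ≤⟨ +-mono-≤ (≤-⟨⟩ d) (*-monoʳ-≤ (F b) ih) ⟩
      F d + F b * F (a ⟨ b ⟩)   ≤⟨ +-monoʳ-≤ (F d) (⟨⟩-supermultiplicative b (a ⟨ b ⟩)) ⟩
      F d + F (b * a ⟨ b ⟩)     ≤⟨ ⟨⟩-superadditive d (b * a ⟨ b ⟩) ⟩
      F (d + b * a ⟨ b ⟩)       ≡⟨ cong F (sym (⟨⟩-digit b d a d<10)) ⟩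
      F ((d + a * 10) ⟨ b ⟩)    ∎
      where open ≤-Reasoning

lemma3 : (a b c : ℕ) → a ≥ 10 → b ≥ 10 → c ≥ 10 → (a ⟨ b ⟩) ⟨ c ⟩ ≥ a ⟨ b ⟨ c ⟩ ⟩
lemma3 a b c _ _ c≥10 = ⟨⟩-⟨⟩-≤ c c≥10 a b
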